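{- Let $s,t$ be real numbers with $s\neq0$, $t\neq0$, and let $d\geq 0$ be an integer. For all integers $n\geq1$, \[ \genfrac{\{}{\}}{0pt}{}{n+d}{d+1}_{s,t}=\sum_{k=1}^{n}\varphi_{s,t}^{(d+1)(n-k)}\,\varphi_{s,t}^{\prime\,(k-1)}\genfrac{\{}{\}}{0pt}{}{k+d-1}{d}_{s,t} \qquad\text{and}\qquad \genfrac{\{}{\}}{0pt}{}{n+d}{d+1}_{s,t}=\sum_{k=1}^{n}\varphi_{s,t}^{\prime\,(d+1)(n-k)}\,\varphi_{s,t}^{k-1}\genfrac{\{}{\}}{0pt}{}{k+d-1}{d}_{s,t}. \]
   Context: The generalized Fibonacci polynomials $\{n\}_{s,t}$ are defined by $\{0\}_{s,t}=0$, $\{1\}_{s,t}=1$, $\{n+2\}_{s,t}=s\{n+1\}_{s,t}+t\{n\}_{s,t}$. Set $\varphi_{s,t}=\frac{s+\sqrt{s^2+4t}}{2}$ and $\varphi'_{s,t}=\frac{s-\sqrt{s^2+4t}}{2}=s-\varphi_{s,t}=-t/\varphi_{s,t}$; exponents on $\varphi'_{s,t}$ denote ordinary powers. The generalized factorial is $\{m\}_{s,t}!=\{1\}_{s,t}\{2\}_{s,t}\cdots\{m\}_{s,t}$ (with $\{0\}_{s,t}!=1$). For integers $n\geq1$, $d\geq0$, the $n$-th generalized simplicial $d$-polytopic number is \[\genfrac{\{}{\}}{0pt}{}{n+d-1}{d}_{s,t}=\frac{\{n\}_{s,t}\{n+1\}_{s,t}\cdots\{n+d-1\}_{s,t}}{\{d\}_{s,t}!}\]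 (the empty product for $d=0$ equals $1$); it coincides with the fibonomial coefficient $\frac{\{n+d-1\}_{s,t}!}{\{d\}_{s,t}!\{n-1\}_{s,t}!}$. Denominators $\{k\}_{s,t}$ appearing are assumed nonzero. -}

module Defs where

open import Level using (Level; suc; _⊔_)
open import Data.Nat as ℕ using (ℕ; zero; _≤_; _∸_)
open import Data.Nat.Properties using (≤-trans; n≤1+n)
open import Relation.Nullary using (¬_)
open import Algebra.Bundles using (CommutativeRing)

record Field (c ℓ : Level) : Set (Level.suc (c ⊔ ℓ)) where
  field
    commRing : CommutativeRing c ℓ
  open CommutativeRing commRing public
  field
    0≉1     : ¬ (0# ≈ 1#)
    inv     : (x : Carrier) → ¬ (x ≈ 0#) → Carrier
    inverse : (x : Carrier) (nz : ¬ (x ≈ 0#)) → x * inv x nz ≈ 1#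

module Fib {c ℓ : Level} (F : Field c ℓ) (s t : Field.Carrier F) where
  open Field F

  pow : Carrier → ℕ → Carrier
  pow x zero      = 1#
  pow x (ℕ.suc m) = x * pow x m

  fib : ℕ → Carrier
  fib zero                = 0#
  fib (ℕ.suc zero)        = 1#
  fib (ℕ.suc (ℕ.suc n))   = s * fib (ℕ.suc n) + t * fib n

  rising : ℕ → ℕ → Carrier
  rising n zero      = 1#
  rising n (ℕ.suc m) = rising n m * fib (n ℕ.+ m)

  NZ : ℕ → Set ℓ
  NZ d = (k : ℕ) → 1 ≤ k → k ≤ d → ¬ (fib k ≈ 0#)

  invFact : (d : ℕ) → NZ d → Carrier
  invFact zero      nz = 1#
  invFact (ℕ.suc d) nz =
    invFact d (λ k 1≤k k≤d → nz k 1≤k (≤-trans k≤d (n≤1+n d)))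
      * inv (fib (ℕ.suc d)) (nz (ℕ.suc d) (ℕ.s≤s ℕ.z≤n) (Data.Nat.Properties.≤-refl))

  -- the n-th generalized simplicial d-polytopic number
  --   {n+d-1 choose d}_{s,t} = {n}{n+1}...{n+d-1} / {d}!
  simplicial : (n d : ℕ) → NZ d → Carrier
  simplicial n d nz = rising n d * invFact d nz

  sum1 : ℕ → (ℕ → Carrier) → Carrier
  sum1 zero      f = 0#
  sum1 (ℕ.suc n) f = sum1 n f + f (ℕ.suc n)

{-# OPTIONS --safe #-}
-- If ψ + ψ' = s and ψ' is a root of x² = s x + t, induction gives the addition law
-- {k+m} = ψ^k {m} + ψ'^m {k}.  For k = d+1, m = n it turns, after division by {d+1}!,
-- into the first-order recurrence S(n+1) = ψ^(d+1) S(n) + ψ'^n T(n+1) between the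
-- simplicial numbers S of dimension d+1 and T of dimension d; unfolding it from S(0) = 0
-- gives the sum.  Exchanging φ and φ', both roots of x² = s x + t, gives the second identity.
module Submission where

open import Defs
open import Level using (Level)
open import Data.Nat as ℕ using (ℕ; zero; suc; _∸_; _≤_)
open import Data.Nat.Properties using (≤-trans; n≤1+n)
import Data.Nat.Properties as ℕₚ
open import Data.Product using (_×_; _,_)
open import Relation.Nullary using (¬_)
open import Relation.Binary.PropositionalEquality using (cong)

module _ {c ℓ : Level} (F : Field c ℓ) (s t : Field.Carrier F) where
  open Field F
  open Fib F s t
  open import Algebra.Properties.Semiring.Exp semiring using (_^_; ^-congˡ; ^-homo-*; ^-assocʳ)
  open import Algebra.Properties.AbelianGroup +-abelianGroup using (∙-cancelˡ)
  open import Algebra.Solver.Ring.NaturalCoefficients.Default commutativeSemiring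
  open import Relation.Binary.Reasoning.Setoid setoid

  pow≈^ : ∀ x m → pow x m ≈ x ^ m
  pow≈^ x zero    = refl
  pow≈^ x (suc m) = *-congˡ (pow≈^ x m)

  pow-+ : ∀ x a b → pow x (a ℕ.+ b) ≈ pow x a * pow x b
  pow-+ x a b = begin
    pow x (a ℕ.+ b)    ≈⟨ pow≈^ x (a ℕ.+ b) ⟩
    x ^ (a ℕ.+ b)      ≈⟨ ^-homo-* x a b ⟩
    x ^ a * x ^ b      ≈⟨ *-cong (pow≈^ x a) (pow≈^ x b) ⟨
    pow x a * pow x b  ∎

  pow-pow : ∀ x a b → pow (pow x a) b ≈ pow x (a ℕ.* b)
  pow-pow x a b = begin
    pow (pow x a) b  ≈⟨ pow≈^ (pow x a) b ⟩
    pow x a ^ b      ≈⟨ ^-congˡ b (pow≈^ x a) ⟩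
    (x ^ a) ^ b      ≈⟨ ^-assocʳ x a b ⟩
    x ^ (a ℕ.* b)    ≈⟨ pow≈^ x (a ℕ.* b) ⟨
    pow x (a ℕ.* b)  ∎

  sum1-cong : ∀ n {f g : ℕ → Carrier} → (∀ k → k ≤ n → f k ≈ g k) → sum1 n f ≈ sum1 n g
  sum1-cong zero    f≈g = refl
  sum1-cong (suc n) f≈g =
    +-cong (sum1-cong n (λ k k≤n → f≈g k (ℕₚ.m≤n⇒m≤1+n k≤n))) (f≈g (suc n) ℕₚ.≤-refl)

  *-distribˡ-sum1 : ∀ x n (f : ℕ → Carrier) → x * sum1 n f ≈ sum1 n (λ k → x * f k)
  *-distribˡ-sum1 x zero    f = zeroʳ x
  *-distribˡ-sum1 x (suc n) f = trans (distribˡ x _ _) (+-congʳ (*-distribˡ-sum1 x n f))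

  unfold-linear-recurrence : (x : Carrier) (a b : ℕ → Carrier) → a 0 ≈ 0# →
    (∀ n → a (suc n) ≈ x * a n + b (suc n)) →
    ∀ n → a n ≈ sum1 n (λ k → pow x (n ∸ k) * b k)
  unfold-linear-recurrence x a b a₀≈0 a-rec zero    = a₀≈0
  unfold-linear-recurrence x a b a₀≈0 a-rec (suc n) = begin
    a (suc n)
      ≈⟨ a-rec n ⟩
    x * a n + b (suc n)
      ≈⟨ +-cong (*-congˡ (unfold-linear-recurrence x a b a₀≈0 a-rec n)) (sym (*-identityˡ _)) ⟩
    x * sum1 n (λ k → pow x (n ∸ k) * b k) + 1# * b (suc n)
      ≈⟨ +-cong (*-distribˡ-sum1 x n _) (*-congʳ (sym (reflexive (cong (pow x) (ℕₚ.n∸n≡0 n))))) ⟩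
    sum1 n (λ k → x * (pow x (n ∸ k) * b k)) + pow x (n ∸ n) * b (suc n)
      ≈⟨ +-congʳ (sum1-cong n shift) ⟩
    sum1 (suc n) (λ k → pow x (suc n ∸ k) * b k)
      ∎
    where
    shift : ∀ k → k ≤ n → x * (pow x (n ∸ k) * b k) ≈ pow x (suc n ∸ k) * b k
    shift k k≤n = begin
      x * (pow x (n ∸ k) * b k)  ≈⟨ *-assoc x _ _ ⟨
      pow x (suc (n ∸ k)) * b k  ≈⟨ *-congʳ (reflexive (cong (pow x) (ℕₚ.+-∸-assoc 1 k≤n))) ⟨
      pow x (suc n ∸ k) * b k    ∎

  conjugate-root : ∀ {ψ ψ'} → ψ + ψ' ≈ s → ψ * ψ ≈ s * ψ + t → ψ' * ψ' ≈ s * ψ' + t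
  conjugate-root {ψ} {ψ'} ψ+ψ'≈s ψ-root = begin
    ψ' * ψ'                 ≈⟨ +-identityʳ _ ⟨
    ψ' * ψ' + 0#            ≈⟨ +-congˡ ψψ'+t≈0 ⟨
    ψ' * ψ' + (ψ * ψ' + t)  ≈⟨ solve 3 (λ x y t → y :* y :+ (x :* y :+ t) := (x :+ y) :* y :+ t) refl ψ ψ' t ⟩
    (ψ + ψ') * ψ' + t       ≈⟨ +-congʳ (*-congʳ ψ+ψ'≈s) ⟩
    s * ψ' + t              ∎
    where
    ψψ'+t≈0 : ψ * ψ' + t ≈ 0#
    ψψ'+t≈0 = ∙-cancelˡ (s * ψ) _ _ (begin
      s * ψ + (ψ * ψ' + t)  ≈⟨ solve 3 (λ a b t → a :+ (b :+ t) := (a :+ t) :+ b) refl (s * ψ) (ψ * ψ') t ⟩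
      (s * ψ + t) + ψ * ψ'  ≈⟨ +-congʳ ψ-root ⟨
      ψ * ψ + ψ * ψ'        ≈⟨ solve 2 (λ x y → x :* x :+ x :* y := (x :+ y) :* x) refl ψ ψ' ⟩
      (ψ + ψ') * ψ          ≈⟨ *-congʳ ψ+ψ'≈s ⟩
      s * ψ                 ≈⟨ +-identityʳ _ ⟨
      s * ψ + 0#            ∎)

  rising-suc-first : ∀ n d → rising n (suc d) ≈ fib n * rising (suc n) d
  rising-suc-first n zero = begin
    1# * fib (n ℕ.+ 0)  ≈⟨ *-congˡ (reflexive (cong fib (ℕₚ.+-identityʳ n))) ⟩
    1# * fib n          ≈⟨ *-comm _ _ ⟩
    fib n * 1#          ∎
  rising-suc-first n (suc d) = begin
    rising n (suc d) * fib (n ℕ.+ suc d)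
      ≈⟨ *-cong (rising-suc-first n d) (reflexive (cong fib (ℕₚ.+-suc n d))) ⟩
    (fib n * rising (suc n) d) * fib (suc n ℕ.+ d)
      ≈⟨ *-assoc _ _ _ ⟩
    fib n * (rising (suc n) d * fib (suc n ℕ.+ d))
      ∎

  NZ-pred : ∀ {d} → NZ (suc d) → NZ d
  NZ-pred {d} nz k 1≤k k≤d = nz k 1≤k (≤-trans k≤d (n≤1+n d))

  fib-suc-*-invFact-suc : ∀ d (nz : NZ (suc d)) →
    fib (suc d) * invFact (suc d) nz ≈ invFact d (NZ-pred nz)
  fib-suc-*-invFact-suc d nz = begin
    f * (I * f⁻¹)  ≈⟨ solve 3 (λ f I g → f :* (I :* g) := I :* (f :* g)) refl f I f⁻¹ ⟩
    I * (f * f⁻¹)  ≈⟨ *-congˡ (inverse f _) ⟩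
    I * 1#         ≈⟨ *-identityʳ I ⟩
    I              ∎
    where
    f = fib (suc d)
    I = invFact d (NZ-pred nz)
    f⁻¹ = inv f (nz (suc d) (ℕ.s≤s ℕ.z≤n) ℕₚ.≤-refl)

  simplicial-zero : ∀ d (nz : NZ (suc d)) → simplicial 0 (suc d) nz ≈ 0#
  simplicial-zero d nz = begin
    rising 0 (suc d) * invFact (suc d) nz        ≈⟨ *-congʳ (rising-suc-first 0 d) ⟩
    (0# * rising 1 d) * invFact (suc d) nz       ≈⟨ *-congʳ (zeroˡ _) ⟩
    0# * invFact (suc d) nz                      ≈⟨ zeroˡ _ ⟩
    0#                                           ∎

  module _ {ψ ψ' : Carrier} (ψ+ψ'≈s : ψ + ψ' ≈ s) (ψ'-root : ψ' * ψ' ≈ s * ψ' + t) where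

    fib-suc : ∀ m → fib (suc m) ≈ ψ * fib m + pow ψ' m
    fib-suc zero = solve 1 (λ x → con 1 := x :* con 0 :+ con 1) refl ψ
    fib-suc (suc zero) = begin
      s * 1# + t * 0#   ≈⟨ solve 2 (λ s t → s :* con 1 :+ t :* con 0 := s) refl s t ⟩
      s                 ≈⟨ ψ+ψ'≈s ⟨
      ψ + ψ'            ≈⟨ solve 2 (λ x y → x :+ y := x :* con 1 :+ y :* con 1) refl ψ ψ' ⟩
      ψ * 1# + ψ' * 1#  ∎
    fib-suc (suc (suc m)) = begin
      s * fib (suc (suc m)) + t * fib (suc m)
        ≈⟨ +-cong (*-congˡ (fib-suc (suc m))) (*-congˡ (fib-suc m)) ⟩
      s * (ψ * fib (suc m) + ψ' * P) + t * (ψ * fib m + P)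
        ≈⟨ solve 7 (λ s t x y a b P → s :* (x :* a :+ y :* P) :+ t :* (x :* b :+ P)
                                      := x :* (s :* a :+ t :* b) :+ (s :* y :+ t) :* P)
                   refl s t ψ ψ' (fib (suc m)) (fib m) P ⟩
      ψ * fib (suc (suc m)) + (s * ψ' + t) * P
        ≈⟨ +-congˡ (*-congʳ ψ'-root) ⟨
      ψ * fib (suc (suc m)) + (ψ' * ψ') * P
        ≈⟨ +-congˡ (*-assoc ψ' ψ' P) ⟩
      ψ * fib (suc (suc m)) + ψ' * (ψ' * P)
        ∎
      where P = pow ψ' m

    fib-+ : ∀ k m → fib (k ℕ.+ m) ≈ pow ψ k * fib m + pow ψ' m * fib k
    fib-+ zero m = solve 2 (λ a P → a := con 1 :* a :+ P :* con 0) refl (fib m) (pow ψ' m)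
    fib-+ (suc k) m = begin
      fib (suc (k ℕ.+ m))
        ≈⟨ fib-suc (k ℕ.+ m) ⟩
      ψ * fib (k ℕ.+ m) + pow ψ' (k ℕ.+ m)
        ≈⟨ +-cong (*-congˡ (fib-+ k m)) (pow-+ ψ' k m) ⟩
      ψ * (pow ψ k * fib m + pow ψ' m * fib k) + pow ψ' k * pow ψ' m
        ≈⟨ solve 6 (λ x a f P g Q → x :* (a :* f :+ P :* g) :+ Q :* P
                                   := (x :* a) :* f :+ P :* (x :* g :+ Q))
                   refl ψ (pow ψ k) (fib m) (pow ψ' m) (fib k) (pow ψ' k) ⟩
      pow ψ (suc k) * fib m + pow ψ' m * (ψ * fib k + pow ψ' k)
        ≈⟨ +-congˡ (*-congˡ (fib-suc k)) ⟨
      pow ψ (suc k) * fib m + pow ψ' m * fib (suc k)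
        ∎

    rising-suc : ∀ n d → rising (suc n) (suc d) ≈
      pow ψ (suc d) * rising n (suc d) + pow ψ' n * (rising (suc n) d * fib (suc d))
    rising-suc n d = begin
      R * fib (suc n ℕ.+ d)
        ≈⟨ *-congˡ (reflexive (cong (λ m → fib (suc m)) (ℕₚ.+-comm n d))) ⟩
      R * fib (suc d ℕ.+ n)
        ≈⟨ *-congˡ (fib-+ (suc d) n) ⟩
      R * (pow ψ (suc d) * fib n + pow ψ' n * fib (suc d))
        ≈⟨ solve 5 (λ R a f P g → R :* (a :* f :+ P :* g) := a :* (f :* R) :+ P :* (R :* g))
                   refl R (pow ψ (suc d)) (fib n) (pow ψ' n) (fib (suc d)) ⟩
      pow ψ (suc d) * (fib n * R) + pow ψ' n * (R * fib (suc d))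
        ≈⟨ +-congʳ (*-congˡ (rising-suc-first n d)) ⟨
      pow ψ (suc d) * rising n (suc d) + pow ψ' n * (R * fib (suc d))
        ∎
      where R = rising (suc n) d

    simplicial-suc : ∀ n d (nz : NZ (suc d)) → simplicial (suc n) (suc d) nz ≈
      pow ψ (suc d) * simplicial n (suc d) nz + pow ψ' n * simplicial (suc n) d (NZ-pred nz)
    simplicial-suc n d nz = begin
      rising (suc n) (suc d) * J
        ≈⟨ *-congʳ (rising-suc n d) ⟩
      (pow ψ (suc d) * rising n (suc d) + pow ψ' n * (R * fib (suc d))) * J
        ≈⟨ solve 6 (λ a r P R f J → (a :* r :+ P :* (R :* f)) :* J := a :* (r :* J) :+ P :* (R :* (f :* J)))
                   refl (pow ψ (suc d)) (rising n (suc d)) (pow ψ' n) R (fib (suc d)) J ⟩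
      pow ψ (suc d) * (rising n (suc d) * J) + pow ψ' n * (R * (fib (suc d) * J))
        ≈⟨ +-congˡ (*-congˡ (*-congˡ (fib-suc-*-invFact-suc d nz))) ⟩
      pow ψ (suc d) * simplicial n (suc d) nz + pow ψ' n * simplicial (suc n) d (NZ-pred nz)
        ∎
      where
      R = rising (suc n) d
      J = invFact (suc d) nz

    simplicial-sum : ∀ d (nz : NZ (suc d)) n → simplicial n (suc d) nz ≈
      sum1 n (λ k → pow ψ (suc d ℕ.* (n ∸ k)) * pow ψ' (k ∸ 1) * simplicial k d (NZ-pred nz))
    simplicial-sum d nz n = begin
      simplicial n (suc d) nz
        ≈⟨ unfold-linear-recurrence (pow ψ (suc d)) (λ m → simplicial m (suc d) nz) b
             (simplicial-zero d nz) (λ m → simplicial-suc m d nz) n ⟩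
      sum1 n (λ k → pow (pow ψ (suc d)) (n ∸ k) * b k)
        ≈⟨ sum1-cong n (λ k _ → trans (*-congʳ (pow-pow ψ (suc d) (n ∸ k))) (sym (*-assoc _ _ _))) ⟩
      sum1 n (λ k → pow ψ (suc d ℕ.* (n ∸ k)) * pow ψ' (k ∸ 1) * simplicial k d (NZ-pred nz))
        ∎
      where
      b : ℕ → Carrier
      b k = pow ψ' (k ∸ 1) * simplicial k d (NZ-pred nz)

-- Both identities also hold for n = 0, and neither needs s ≠ 0 nor t ≠ 0.
theorem1 : {c ℓ : Level} (F : Field c ℓ) →
    let open Field F in
    (s t φ φ' : Carrier) →
    ¬ (s ≈ 0#) → ¬ (t ≈ 0#) →
    φ * φ ≈ s * φ + t →
    φ' ≈ s - φ →
    let open Fib F s t in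
    (d : ℕ) → (nz : NZ (suc d)) →
    let nzd : NZ d
        nzd = λ k 1≤k k≤d → nz k 1≤k (≤-trans k≤d (n≤1+n d))
    in
    (n : ℕ) → 1 ≤ n →
      (simplicial n (suc d) nz
        ≈ sum1 n (λ k → pow φ ((suc d) ℕ.* (n ∸ k)) * pow φ' (k ∸ 1) * simplicial k d nzd))
    × (simplicial n (suc d) nz
        ≈ sum1 n (λ k → pow φ' ((suc d) ℕ.* (n ∸ k)) * pow φ (k ∸ 1) * simplicial k d nzd))
theorem1 F s t φ φ' _ _ φ-root φ'≈s-φ d nz n _ =
    simplicial-sum F s t φ+φ'≈s (conjugate-root F s t φ+φ'≈s φ-root) d nz n
  , simplicial-sum F s t (trans (+-comm φ' φ) φ+φ'≈s) φ-root d nz n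
  where
  open Field F
  open import Algebra.Properties.AbelianGroup +-abelianGroup using (xyx⁻¹≈y)
  φ+φ'≈s : φ + φ' ≈ s
  φ+φ'≈s = trans (+-congˡ φ'≈s-φ) (trans (sym (+-assoc φ s (- φ))) (xyx⁻¹≈y φ s))
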